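{- For all odd integers $j\ge3$ and $a_{j+2}\ge3$, the tree $RT(0^j,1,a_{j+2})$ is super edge-graceful.
   Context: For a finite simple graph $G$ with $p$ vertices and $q$ edges, $G$ is super edge-graceful if there is a bijection $f$ from $E(G)$ onto $\{0,\pm1,\ldots,\pm\frac{q-1}{2}\}$ when $q$ is odd, and onto $\{\pm1,\ldots,\pm\frac{q}{2}\}$ when $q$ is even, such that the induced vertex labeling $f^+(v)=\sum_{uv\in E(G)} f(uv)$ is a bijection from $V(G)$ onto $\{0,\pm1,\ldots,\pm\frac{p-1}{2}\}$ when $p$ is odd, and onto $\{\pm1,\ldots,\pm\frac{p}{2}\}$ when $p$ is even. $RT(0^j,a,b)$ denotes the rooted tree with root $v_0$ having $j+2$ children: $j$ of them are leaves, one has exactly $a$ children (all leaves) and one has exactly $b$ children (all leaves). -}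

module Defs where

open import Data.Nat as ℕ using (ℕ; zero; suc; _+_; _*_; _≡ᵇ_; _/_)
open import Data.Nat.Base using (_%_)
open import Data.Integer as ℤ using (ℤ; +_; ∣_∣)
open import Data.Fin using (Fin; zero; suc; toℕ)
open import Data.Bool using (Bool; true; false; if_then_else_; _∨_)
open import Data.List using (List; []; _∷_; _++_; map; length; lookup; upTo)
open import Data.Product using (_×_; _,_; proj₁; proj₂; Σ; ∃)
open import Relation.Binary.PropositionalEquality using (_≡_; _≢_)
open import Function.Definitions using (Injective)

-- A finite graph on vertex set {0,…,p-1} (as Fin p), given by its list of
-- edges; each edge is an unordered pair written as a pair of naturals.
record Graph : Set where
  field
    p     : ℕ
    edges : List (ℕ × ℕ)
  q : ℕ
  q = length edges

open Graph public

sumFin : (n : ℕ) → (Fin n → ℤ) → ℤ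
sumFin zero    f = + 0
sumFin (suc n) f = f zero ℤ.+ sumFin n (λ i → f (suc i))

LabelSet : ℕ → ℤ → Set
LabelSet n z with n % 2
... | 0 = (z ≢ + 0) × (∣ z ∣ ℕ.≤ n / 2)
... | _ = ∣ z ∣ ℕ.≤ n / 2

BijOnto : (n m : ℕ) → (Fin n → ℤ) → Set
BijOnto n m f =
  (∀ i → LabelSet m (f i)) ×
  Injective _≡_ _≡_ f ×
  (∀ z → LabelSet m z → ∃ λ i → f i ≡ z)

incident : ℕ → ℕ × ℕ → Bool
incident v (a , b) = (v ≡ᵇ a) ∨ (v ≡ᵇ b)

inducedLabel : (G : Graph) → (Fin (q G) → ℤ) → Fin (p G) → ℤ
inducedLabel G f v =
  sumFin (q G) (λ e → if incident (toℕ v) (lookup (edges G) e) then f e else + 0)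

SuperEdgeGraceful : Graph → Set
SuperEdgeGraceful G =
  Σ (Fin (q G) → ℤ) λ f →
    BijOnto (q G) (q G) f × BijOnto (p G) (p G) (inducedLabel G f)

-- RT(0^j, a, b): root 0; leaf children 1..j; child j+1 with a leaf children;
-- child j+2 with b leaf children.  Leaves of j+1: j+3 .. j+2+a;
-- leaves of j+2: j+3+a .. j+2+a+b.
RT : (j a b : ℕ) → Graph
RT j a b = record
  { p = j + a + b + 3
  ; edges = map (λ i → (0 , suc i)) (upTo j)
            ++ (0 , j + 1) ∷ (0 , j + 2) ∷
               map (λ k → (j + 1 , j + 3 + k)) (upTo a)
            ++ map (λ k → (j + 2 , j + 3 + a + k)) (upTo b)
  }

Odd : ℕ → Set
Odd n = ∃ λ k → n ≡ suc (2 * k)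

-- Number the edges of RT(0^j, 1, b) so that edge t joins vertex t + 1 to its parent.  Then every
-- leaf t + 1 receives exactly the label of edge t, and only the root and its two inner children
-- need computation.  We label edge t by the π(t)-th element of the label set in the order
-- 0, 1, −1, 2, −2, … (starting at 1 when no 0 is available), for an explicit permutation π that
-- puts runs of such consecutive pairs x, −x on the edges at the root and at j + 2; the leaves
-- then carry all vertex labels except three, and these are exactly the sums at the inner vertices.
module Submission where

open import Defs
open import Data.Nat using (ℕ; _≤_)
open import Data.Nat using (zero; suc; _+_; _*_; _∸_; _<_; z≤n; s≤s; _≡ᵇ_; _<ᵇ_; _/_; _%_; _≟_; _<?_)
import Data.Nat.Properties as ℕP
open import Data.Nat.DivMod using (m*n%n≡0; m*n/n≡m; [m+kn]%n≡m%n; +-distrib-/)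
open import Data.Nat.Tactic.RingSolver using (solve-∀)
open import Data.Integer using (ℤ; +_; -[1+_]; ∣_∣) renaming (_+_ to _+ᶻ_)
import Data.Integer.Properties as ℤP
open import Data.Fin using (Fin; toℕ; fromℕ<; punchOut)
import Data.Fin.Properties as FinP
open import Data.Bool using (true; false; if_then_else_)
open import Data.Bool.Properties using (∨-zeroʳ)
open import Data.List using (List; []; _∷_; _++_; map; length; lookup; upTo; applyUpTo)
import Data.List.Properties as ListP
open import Data.Product using (_×_; _,_; proj₁; proj₂; ∃; map₂)
open import Data.Sum using (_⊎_; inj₁; inj₂)
open import Data.Empty using (⊥-elim)
open import Relation.Nullary using (yes; no; contradiction)
open import Relation.Nullary.Decidable using (dec-true; dec-false)
open import Relation.Binary.PropositionalEquality
open import Function using (_∘_; id; _⇔_; mk⇔; module Equivalence)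
open import Function.Definitions using (Injective)

Fin-injective⇒surjective : ∀ {n} (g : Fin n → Fin n) → Injective _≡_ _≡_ g → ∀ k → ∃ λ i → g i ≡ k
Fin-injective⇒surjective {zero} g inj ()
Fin-injective⇒surjective {suc n} g inj k with FinP.any? (λ i → g i FinP.≟ k)
... | yes hit = hit
... | no miss = contradiction (FinP.injective⇒≤ punched-injective) ℕP.1+n≰n
  where
  k≢g : ∀ i → k ≢ g i
  k≢g i k≡gi = miss (i , sym k≡gi)
  punched : Fin (suc n) → Fin n
  punched i = punchOut (k≢g i)
  punched-injective : Injective _≡_ _≡_ punched
  punched-injective eq = inj (FinP.punchOut-injective (k≢g _) (k≢g _) eq)

-- The section of g is injective, hence onto, hence a two-sided inverse of g.
Fin-surjective⇒injective : ∀ {n} (g : Fin n → Fin n) → (∀ k → ∃ λ i → g i ≡ k) → Injective _≡_ _≡_ g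
Fin-surjective⇒injective {n} g onto {a} {b} ga≡gb =
  trans (sym (section-retraction a)) (trans (cong section ga≡gb) (section-retraction b))
  where
  section : Fin n → Fin n
  section k = proj₁ (onto k)
  section-injective : Injective _≡_ _≡_ section
  section-injective {x} {y} eq = trans (sym (proj₂ (onto x))) (trans (cong g eq) (proj₂ (onto y)))
  section-retraction : ∀ a → section (g a) ≡ a
  section-retraction a with Fin-injective⇒surjective section section-injective a
  ... | k , refl = cong section (proj₂ (onto k))

Permutes : ℕ → (ℕ → ℕ) → Set
Permutes n σ = (∀ t → t < n → σ t < n) × (∀ s → s < n → ∃ λ t → t < n × σ t ≡ s)

Permutes-injective : ∀ {n σ} → Permutes n σ → ∀ {a b} → a < n → b < n → σ a ≡ σ b → a ≡ b
Permutes-injective {n} {σ} (σ-into , σ-onto) a<n b<n σa≡σb =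
  trans (sym (FinP.toℕ-fromℕ< a<n))
    (trans (cong toℕ (Fin-surjective⇒injective σ↾ σ↾-onto (FinP.toℕ-injective σ↾a≡σ↾b)))
           (FinP.toℕ-fromℕ< b<n))
  where
  σ↾ : Fin n → Fin n
  σ↾ i = fromℕ< (σ-into (toℕ i) (FinP.toℕ<n i))
  toℕ-σ↾ : ∀ {t} (t<n : t < n) → toℕ (σ↾ (fromℕ< t<n)) ≡ σ t
  toℕ-σ↾ t<n = trans (FinP.toℕ-fromℕ< _) (cong σ (FinP.toℕ-fromℕ< t<n))
  σ↾-onto : ∀ k → ∃ λ i → σ↾ i ≡ k
  σ↾-onto k with σ-onto (toℕ k) (FinP.toℕ<n k)
  ... | t , t<n , σt≡k = fromℕ< t<n , FinP.toℕ-injective (trans (toℕ-σ↾ t<n) σt≡k)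
  σ↾a≡σ↾b : toℕ (σ↾ (fromℕ< a<n)) ≡ toℕ (σ↾ (fromℕ< b<n))
  σ↾a≡σ↾b = trans (toℕ-σ↾ a<n) (trans σa≡σb (sym (toℕ-σ↾ b<n)))

Permutes-∘ : ∀ {n σ τ} → Permutes n σ → Permutes n τ → Permutes n (σ ∘ τ)
Permutes-∘ {n} {σ} {τ} (σ-into , σ-onto) (τ-into , τ-onto) =
  (λ t t<n → σ-into _ (τ-into t t<n)) , onto
  where
  onto : ∀ s → s < n → ∃ λ t → t < n × σ (τ t) ≡ s
  onto s s<n with σ-onto s s<n
  ... | u , u<n , σu≡s with τ-onto u u<n
  ...   | t , t<n , τt≡u = t , t<n , trans (cong σ τt≡u) σu≡s

lift : (ℕ → ℕ) → ℕ → ℕ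
lift σ zero = zero
lift σ (suc t) = suc (σ t)

Permutes-lift : ∀ {n σ} → Permutes n σ → Permutes (suc n) (lift σ)
Permutes-lift {n} {σ} (σ-into , σ-onto) = into , onto
  where
  into : ∀ t → t < suc n → lift σ t < suc n
  into zero _ = s≤s z≤n
  into (suc t) (s≤s t<n) = s≤s (σ-into t t<n)
  onto : ∀ s → s < suc n → ∃ λ t → t < suc n × lift σ t ≡ s
  onto zero _ = zero , s≤s z≤n , refl
  onto (suc s) (s≤s s<n) with σ-onto s s<n
  ... | t , t<n , σt≡s = suc t , s≤s t<n , cong suc σt≡s

rotate : ℕ → ℕ → ℕ
rotate n zero = n ∸ 1
rotate n (suc t) = t

Permutes-rotate : ∀ n → Permutes n (rotate n)
Permutes-rotate zero = (λ _ ()) , (λ _ ())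
Permutes-rotate (suc n) = into , onto
  where
  into : ∀ t → t < suc n → rotate (suc n) t < suc n
  into zero _ = ℕP.n<1+n n
  into (suc t) (s≤s t<n) = ℕP.m<n⇒m<1+n t<n
  onto : ∀ s → s < suc n → ∃ λ t → t < suc n × rotate (suc n) t ≡ s
  onto s (s≤s s≤n) with s ≟ n
  ... | yes refl = zero , s≤s z≤n , refl
  ... | no s≢n = suc s , s≤s (ℕP.≤∧≢⇒< s≤n s≢n) , refl

≡ᵇ-true : ∀ {m n} → m ≡ n → (m ≡ᵇ n) ≡ true
≡ᵇ-true {m} {n} = dec-true (m ≟ n)

≡ᵇ-false : ∀ {m n} → m ≢ n → (m ≡ᵇ n) ≡ false
≡ᵇ-false {m} {n} = dec-false (m ≟ n)

transpose : ℕ → ℕ → ℕ → ℕ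
transpose x y v = if v ≡ᵇ x then y else if v ≡ᵇ y then x else v

transpose-≡ˡ : ∀ x y → transpose x y x ≡ y
transpose-≡ˡ x y rewrite ≡ᵇ-true {x} refl = refl

transpose-≡ʳ : ∀ x y → transpose x y y ≡ x
transpose-≡ʳ x y with y ≟ x
... | yes y≡x rewrite ≡ᵇ-true y≡x = y≡x
... | no y≢x rewrite ≡ᵇ-false y≢x | ≡ᵇ-true {y} refl = refl

transpose-≢ : ∀ x y {v} → v ≢ x → v ≢ y → transpose x y v ≡ v
transpose-≢ x y v≢x v≢y rewrite ≡ᵇ-false v≢x | ≡ᵇ-false v≢y = refl

transpose-involutive : ∀ x y v → transpose x y (transpose x y v) ≡ v
transpose-involutive x y v with v ≟ x | v ≟ y
... | yes refl | _ = trans (cong (transpose v y) (transpose-≡ˡ v y)) (transpose-≡ʳ v y)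
... | no _ | yes refl = trans (cong (transpose x v) (transpose-≡ʳ x v)) (transpose-≡ˡ x v)
... | no v≢x | no v≢y = trans (cong (transpose x y) (transpose-≢ x y v≢x v≢y)) (transpose-≢ x y v≢x v≢y)

Permutes-transpose : ∀ {n x y} → x < n → y < n → Permutes n (transpose x y)
Permutes-transpose {n} {x} {y} x<n y<n = into , λ s s<n → transpose x y s , into s s<n , transpose-involutive x y s
  where
  into : ∀ t → t < n → transpose x y t < n
  into t t<n with t ≟ x | t ≟ y
  ... | yes refl | _ = subst (_< n) (sym (transpose-≡ˡ t y)) y<n
  ... | no _ | yes refl = subst (_< n) (sym (transpose-≡ʳ x t)) x<n
  ... | no t≢x | no t≢y = subst (_< n) (sym (transpose-≢ x y t≢x t≢y)) t<n

sumTo : ℕ → (ℕ → ℤ) → ℤ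
sumTo zero G = + 0
sumTo (suc n) G = G 0 +ᶻ sumTo n (G ∘ suc)

sumTo-cong : ∀ n {G H} → (∀ t → t < n → G t ≡ H t) → sumTo n G ≡ sumTo n H
sumTo-cong zero G≡H = refl
sumTo-cong (suc n) G≡H = cong₂ _+ᶻ_ (G≡H 0 (s≤s z≤n)) (sumTo-cong n (λ t t<n → G≡H (suc t) (s≤s t<n)))

sumTo-zero : ∀ n {G} → (∀ t → t < n → G t ≡ + 0) → sumTo n G ≡ + 0
sumTo-zero zero G≡0 = refl
sumTo-zero (suc n) G≡0 =
  cong₂ _+ᶻ_ (G≡0 0 (s≤s z≤n)) (sumTo-zero n (λ t t<n → G≡0 (suc t) (s≤s t<n)))

sumTo-single : ∀ n {G} t₀ → t₀ < n → (∀ t → t < n → t ≢ t₀ → G t ≡ + 0) → sumTo n G ≡ G t₀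
sumTo-single (suc n) {G} zero _ G≡0 =
  trans (cong (G 0 +ᶻ_) (sumTo-zero n (λ t t<n → G≡0 (suc t) (s≤s t<n) λ ()))) (ℤP.+-identityʳ (G 0))
sumTo-single (suc n) {G} (suc t₀) (s≤s t₀<n) G≡0 =
  trans (cong₂ _+ᶻ_ (G≡0 0 (s≤s z≤n) λ ()) (sumTo-single n t₀ t₀<n λ t t<n t≢t₀ → G≡0 (suc t) (s≤s t<n) (t≢t₀ ∘ ℕP.suc-injective)))
        (ℤP.+-identityˡ (G (suc t₀)))

sumTo-snoc : ∀ n G → sumTo (suc n) G ≡ sumTo n G +ᶻ G n
sumTo-snoc zero G = trans (ℤP.+-identityʳ (G 0)) (sym (ℤP.+-identityˡ (G 0)))
sumTo-snoc (suc n) G = trans (cong (G 0 +ᶻ_) (sumTo-snoc n (G ∘ suc))) (sym (ℤP.+-assoc (G 0) _ _))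

sumTo-+2 : ∀ n G → sumTo (n + 2) G ≡ sumTo n G +ᶻ G n +ᶻ G (suc n)
sumTo-+2 n G = trans (cong (λ m → sumTo m G) (ℕP.+-comm n 2))
                     (trans (sumTo-snoc (suc n) G) (cong (_+ᶻ G (suc n)) (sumTo-snoc n G)))

outward : ℤ → ℤ
outward (+ m) = + suc m
outward -[1+ m ] = -[1+ suc m ]

zigzag : ℕ → ℤ
zigzag zero = + 1
zigzag (suc zero) = -[1+ 0 ]
zigzag (suc (suc n)) = outward (zigzag n)

zigzag₀ : ℕ → ℤ
zigzag₀ zero = + 0
zigzag₀ (suc n) = zigzag n

zigzag-even : ∀ k → zigzag (2 * k) ≡ + suc k
zigzag-even zero = refl
zigzag-even (suc k) = trans (cong zigzag (ℕP.*-suc 2 k)) (cong outward (zigzag-even k))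

zigzag-odd : ∀ k → zigzag (suc (2 * k)) ≡ -[1+ k ]
zigzag-odd zero = refl
zigzag-odd (suc k) = trans (cong (zigzag ∘ suc) (ℕP.*-suc 2 k)) (cong outward (zigzag-odd k))

even⊎odd : ∀ n → ∃ λ k → n ≡ 2 * k ⊎ n ≡ suc (2 * k)
even⊎odd zero = 0 , inj₁ refl
even⊎odd (suc zero) = 0 , inj₂ refl
even⊎odd (suc (suc n)) with even⊎odd n
... | k , inj₁ refl = suc k , inj₁ (sym (ℕP.*-suc 2 k))
... | k , inj₂ refl = suc k , inj₂ (cong suc (sym (ℕP.*-suc 2 k)))

[2*M]%2≡0 : ∀ M → (2 * M) % 2 ≡ 0
[2*M]%2≡0 M = trans (cong (_% 2) (ℕP.*-comm 2 M)) (m*n%n≡0 M 2)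

[2*M]/2≡M : ∀ M → (2 * M) / 2 ≡ M
[2*M]/2≡M M = trans (cong (_/ 2) (ℕP.*-comm 2 M)) (m*n/n≡m M 2)

[1+2*M]%2≡1 : ∀ M → suc (2 * M) % 2 ≡ 1
[1+2*M]%2≡1 M = trans (cong (λ n → (1 + n) % 2) (ℕP.*-comm 2 M)) ([m+kn]%n≡m%n 1 M 2)

[1+2*M]/2≡M : ∀ M → suc (2 * M) / 2 ≡ M
[1+2*M]/2≡M M = trans (cong (λ n → (1 + n) / 2) (ℕP.*-comm 2 M))
  (trans (+-distrib-/ 1 (M * 2) (subst (λ r → 1 + r < 2) (sym (m*n%n≡0 M 2)) ℕP.≤-refl)) (m*n/n≡m M 2))

LabelSet-even : ∀ M z → LabelSet (2 * M) z ⇔ (z ≢ + 0 × ∣ z ∣ ≤ M)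
LabelSet-even M z with (2 * M) % 2 | [2*M]%2≡0 M
... | 0 | _ = mk⇔ (map₂ (subst (∣ z ∣ ≤_) ([2*M]/2≡M M)))
                  (map₂ (subst (∣ z ∣ ≤_) (sym ([2*M]/2≡M M))))

LabelSet-odd : ∀ M z → LabelSet (suc (2 * M)) z ⇔ ∣ z ∣ ≤ M
LabelSet-odd M z with suc (2 * M) % 2 | [1+2*M]%2≡1 M
... | 1 | _ = mk⇔ (subst (∣ z ∣ ≤_) ([1+2*M]/2≡M M)) (subst (∣ z ∣ ≤_) (sym ([1+2*M]/2≡M M)))

Enumerates : ℕ → (ℕ → ℤ) → Set
Enumerates n S =
  (∀ k → k < n → LabelSet n (S k)) × Injective _≡_ _≡_ S × (∀ z → LabelSet n z → ∃ λ k → k < n × S k ≡ z)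

zigzag≢0 : ∀ k → zigzag k ≢ + 0
zigzag≢0 k with even⊎odd k
... | i , inj₁ refl rewrite zigzag-even i = λ ()
... | i , inj₂ refl rewrite zigzag-odd i = λ ()

∣zigzag∣≤ : ∀ M k → k < 2 * M → ∣ zigzag k ∣ ≤ M
∣zigzag∣≤ M k k<2M with even⊎odd k
... | i , inj₁ refl rewrite zigzag-even i = ℕP.*-cancelˡ-< 2 i M k<2M
... | i , inj₂ refl rewrite zigzag-odd i = ℕP.*-cancelˡ-< 2 i M (ℕP.<-trans (ℕP.n<1+n _) k<2M)

zigzag-injective : Injective _≡_ _≡_ zigzag
zigzag-injective {a} {b} eq with even⊎odd a | even⊎odd b
... | i , inj₁ refl | i′ , inj₁ refl rewrite zigzag-even i | zigzag-even i′ with eq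
...   | refl = refl
zigzag-injective eq | i , inj₁ refl | i′ , inj₂ refl rewrite zigzag-even i | zigzag-odd i′ with eq
...   | ()
zigzag-injective eq | i , inj₂ refl | i′ , inj₁ refl rewrite zigzag-odd i | zigzag-even i′ with eq
...   | ()
zigzag-injective eq | i , inj₂ refl | i′ , inj₂ refl rewrite zigzag-odd i | zigzag-odd i′ with eq
...   | refl = refl

zigzag-onto : ∀ M z → z ≢ + 0 → ∣ z ∣ ≤ M → ∃ λ k → k < 2 * M × zigzag k ≡ z
zigzag-onto M (+ zero) z≢0 _ = ⊥-elim (z≢0 refl)
zigzag-onto M (+ suc i) _ i<M = 2 * i , ℕP.*-monoʳ-< 2 i<M , zigzag-even i
zigzag-onto M -[1+ i ] _ i<M =
  suc (2 * i) , subst (_≤ 2 * M) (ℕP.*-suc 2 i) (ℕP.*-monoʳ-≤ 2 i<M) , zigzag-odd i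

zigzag-enumerates : ∀ M → Enumerates (2 * M) zigzag
zigzag-enumerates M =
  (λ k k<2M → Equivalence.from (LabelSet-even M (zigzag k)) (zigzag≢0 k , ∣zigzag∣≤ M k k<2M)) ,
  zigzag-injective ,
  λ z z∈ → let (z≢0 , ∣z∣≤M) = Equivalence.to (LabelSet-even M z) z∈ in zigzag-onto M z z≢0 ∣z∣≤M

zigzag₀-enumerates : ∀ M → Enumerates (suc (2 * M)) zigzag₀
zigzag₀-enumerates M = into , injective , onto
  where
  into : ∀ k → k < suc (2 * M) → LabelSet (suc (2 * M)) (zigzag₀ k)
  into zero _ = Equivalence.from (LabelSet-odd M (+ 0)) z≤n
  into (suc k) (s≤s k<2M) = Equivalence.from (LabelSet-odd M _) (∣zigzag∣≤ M k k<2M)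
  injective : Injective _≡_ _≡_ zigzag₀
  injective {zero} {zero} _ = refl
  injective {zero} {suc b} eq = ⊥-elim (zigzag≢0 b (sym eq))
  injective {suc a} {zero} eq = ⊥-elim (zigzag≢0 a eq)
  injective {suc a} {suc b} eq = cong suc (zigzag-injective eq)
  onto : ∀ z → LabelSet (suc (2 * M)) z → ∃ λ k → k < suc (2 * M) × zigzag₀ k ≡ z
  onto (+ zero) _ = zero , s≤s z≤n , refl
  onto (+ suc i) z∈ with zigzag-onto M (+ suc i) (λ ()) (Equivalence.to (LabelSet-odd M _) z∈)
  ... | k , k<2M , eq = suc k , s≤s k<2M , eq
  onto -[1+ i ] z∈ with zigzag-onto M -[1+ i ] (λ ()) (Equivalence.to (LabelSet-odd M _) z∈)
  ... | k , k<2M , eq = suc k , s≤s k<2M , eq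

BijOnto-enumerate∘permute : ∀ {n S σ} → Enumerates n S → Permutes n σ → BijOnto n n (λ i → S (σ (toℕ i)))
BijOnto-enumerate∘permute {n} {S} {σ} (S-into , S-injective , S-onto) σ-perm@(σ-into , σ-onto) =
  (λ i → S-into _ (σ-into _ (FinP.toℕ<n i))) ,
  (λ {a} {b} eq → FinP.toℕ-injective (Permutes-injective σ-perm (FinP.toℕ<n a) (FinP.toℕ<n b) (S-injective eq))) ,
  onto
  where
  onto : ∀ z → LabelSet n z → ∃ λ i → S (σ (toℕ i)) ≡ z
  onto z z∈ with S-onto z z∈
  ... | k , k<n , Sk≡z with σ-onto k k<n
  ...   | t , t<n , σt≡k = fromℕ< t<n , trans (cong (S ∘ σ) (FinP.toℕ-fromℕ< t<n)) (trans (cong S σt≡k) Sk≡z)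

BijOnto-cong : ∀ {n m} {f g : Fin n → ℤ} → (∀ i → f i ≡ g i) → BijOnto n m f → BijOnto n m g
BijOnto-cong {m = m} f≡g (into , injective , onto) =
  (λ i → subst (LabelSet m) (f≡g i) (into i)) ,
  (λ {x} {y} eq → injective (trans (f≡g x) (trans eq (sym (f≡g y))))) ,
  λ z z∈ → let (i , fi≡z) = onto z z∈ in i , trans (sym (f≡g i)) fi≡z

sumTo-zigzag-cancel : ∀ u {c} w → c ≡ 2 * w → sumTo (2 * u) (λ i → zigzag (c + i)) ≡ + 0
sumTo-zigzag-cancel zero w _ = refl
sumTo-zigzag-cancel (suc u) {c} w refl = begin
  sumTo (2 * suc u) G                                          ≡⟨ cong (λ n → sumTo n G) (ℕP.*-suc 2 u) ⟩
  G 0 +ᶻ (G 1 +ᶻ sumTo (2 * u) (λ i → G (2 + i)))            ≡⟨ ℤP.+-assoc (G 0) (G 1) _ ⟨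
  (G 0 +ᶻ G 1) +ᶻ sumTo (2 * u) (λ i → G (2 + i))            ≡⟨ cong₂ _+ᶻ_ first-pair rest ⟩
  + 0 +ᶻ + 0                                                   ∎
  where
  open ≡-Reasoning
  G : ℕ → ℤ
  G i = zigzag (2 * w + i)
  first-pair : G 0 +ᶻ G 1 ≡ + 0
  first-pair rewrite ℕP.+-identityʳ (2 * w) | ℕP.+-comm (2 * w) 1 | zigzag-even w | zigzag-odd w = ℤP.n⊖n≡0 (suc w)
  shift : ∀ w i → 2 * w + (2 + i) ≡ 2 * suc w + i
  shift = solve-∀
  rest : sumTo (2 * u) (λ i → G (2 + i)) ≡ + 0
  rest = trans (sumTo-cong (2 * u) (λ i _ → cong zigzag (shift w i))) (sumTo-zigzag-cancel u (suc w) refl)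

<-split : ∀ m t → t < m ⊎ ∃ λ k → t ≡ m + k
<-split m t with t <? m
... | yes t<m = inj₁ t<m
... | no t≮m = inj₂ (t ∸ m , sym (ℕP.m+[n∸m]≡n (ℕP.≮⇒≥ t≮m)))

incidentSum : ℕ → (ℕ → ℤ) → List (ℕ × ℕ) → ℤ
incidentSum v F [] = + 0
incidentSum v F (e ∷ es) = (if incident v e then F 0 else + 0) +ᶻ incidentSum v (F ∘ suc) es

sumFin-incident≡incidentSum : ∀ v F es →
  sumFin (length es) (λ e → if incident v (lookup es e) then F (toℕ e) else + 0) ≡ incidentSum v F es
sumFin-incident≡incidentSum v F [] = refl
sumFin-incident≡incidentSum v F (e ∷ es) =
  cong ((if incident v e then F 0 else + 0) +ᶻ_) (sumFin-incident≡incidentSum v (F ∘ suc) es)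

inducedLabel≡incidentSum : ∀ G F v → inducedLabel G (F ∘ toℕ) v ≡ incidentSum (toℕ v) F (edges G)
inducedLabel≡incidentSum G F v = sumFin-incident≡incidentSum (toℕ v) F (edges G)

incidentSum-++ : ∀ v F xs ys →
  incidentSum v F (xs ++ ys) ≡ incidentSum v F xs +ᶻ incidentSum v (λ t → F (length xs + t)) ys
incidentSum-++ v F [] ys = sym (ℤP.+-identityˡ _)
incidentSum-++ v F (x ∷ xs) ys =
  trans (cong ((if incident v x then F 0 else + 0) +ᶻ_) (incidentSum-++ v (F ∘ suc) xs ys))
        (sym (ℤP.+-assoc (if incident v x then F 0 else + 0) _ _))

star : ℕ → ℕ → ℕ → List (ℕ × ℕ)
star c d n = map (λ k → (c , d + k)) (upTo n)

length-star : ∀ c d n → length (star c d n) ≡ n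
length-star c d n = trans (ListP.length-map _ (upTo n)) (ListP.length-upTo n)

starSum : ℕ → ℕ → ℕ → ℕ → (ℕ → ℤ) → ℤ
starSum v c d n F = sumTo n (λ k → if incident v (c , d + k) then F k else + 0)

incidentSum-map-applyUpTo : ∀ v F c d g n →
  incidentSum v F (map (λ k → (c , d + k)) (applyUpTo g n)) ≡ sumTo n (λ k → if incident v (c , d + g k) then F k else + 0)
incidentSum-map-applyUpTo v F c d g zero = refl
incidentSum-map-applyUpTo v F c d g (suc n) =
  cong ((if incident v (c , d + g 0) then F 0 else + 0) +ᶻ_) (incidentSum-map-applyUpTo v (F ∘ suc) c d (g ∘ suc) n)

incidentSum-star : ∀ v c d n F → incidentSum v F (star c d n) ≡ starSum v c d n F
incidentSum-star v c d n F = incidentSum-map-applyUpTo v F c d id n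

incident-≡ˡ : ∀ {v a b} → v ≡ a → incident v (a , b) ≡ true
incident-≡ˡ v≡a rewrite ≡ᵇ-true v≡a = refl

incident-≡ʳ : ∀ {v a b} → v ≡ b → incident v (a , b) ≡ true
incident-≡ʳ {v} {a} v≡b rewrite ≡ᵇ-true v≡b = ∨-zeroʳ (v ≡ᵇ a)

incident-≢ : ∀ {v a b} → v ≢ a → v ≢ b → incident v (a , b) ≡ false
incident-≢ v≢a v≢b rewrite ≡ᵇ-false v≢a | ≡ᵇ-false v≢b = refl

starSum-centre : ∀ v c d n F → v ≡ c → starSum v c d n F ≡ sumTo n F
starSum-centre v c d n F v≡c =
  sumTo-cong n (λ k _ → cong (λ β → if β then F k else + 0) (incident-≡ˡ v≡c))

starSum-leaf : ∀ v c d n F k₀ → k₀ < n → v ≡ d + k₀ → v ≢ c → starSum v c d n F ≡ F k₀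
starSum-leaf v c d n F k₀ k₀<n v≡d+k₀ v≢c =
  trans (sumTo-single n k₀ k₀<n (λ k _ k≢k₀ → cong (λ β → if β then F k else + 0) (incident-≢ v≢c (v≢d+k k≢k₀))))
        (cong (λ β → if β then F k₀ else + 0) (incident-≡ʳ v≡d+k₀))
  where
  v≢d+k : ∀ {k} → k ≢ k₀ → v ≢ d + k
  v≢d+k k≢k₀ v≡d+k = k≢k₀ (ℕP.+-cancelˡ-≡ d _ _ (trans (sym v≡d+k) v≡d+k₀))

starSum-away : ∀ v c d n F → v ≢ c → v < d ⊎ d + n ≤ v → starSum v c d n F ≡ + 0
starSum-away v c d n F v≢c outside =
  sumTo-zero n (λ k k<n → cong (λ β → if β then F k else + 0) (incident-≢ v≢c (v≢d+k outside k<n)))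
  where
  v≢d+k : v < d ⊎ d + n ≤ v → ∀ {k} → k < n → v ≢ d + k
  v≢d+k (inj₁ v<d) _ = ℕP.<⇒≢ (ℕP.<-≤-trans v<d (ℕP.m≤m+n d _))
  v≢d+k (inj₂ d+n≤v) k<n = ≢-sym (ℕP.<⇒≢ (ℕP.<-≤-trans (ℕP.+-monoʳ-< d k<n) d+n≤v))

applyUpTo-+ : ∀ {A : Set} (g : ℕ → A) m n → applyUpTo g (m + n) ≡ applyUpTo g m ++ applyUpTo (λ k → g (m + k)) n
applyUpTo-+ g zero n = refl
applyUpTo-+ g (suc m) n = cong (g 0 ∷_) (applyUpTo-+ (g ∘ suc) m n)

RT-edges : ∀ j a b → edges (RT j a b) ≡ star 0 1 (j + 2) ++ star (j + 1) (j + 3) a ++ star (j + 2) (j + 3 + a) b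
RT-edges j a b = begin
  map root-edge (upTo j) ++ ((0 , j + 1) ∷ (0 , j + 2) ∷ []) ++ rest
    ≡⟨ cong (λ es → map root-edge (upTo j) ++ es ++ rest) middle ⟩
  map root-edge (upTo j) ++ map root-edge (applyUpTo (λ k → j + k) 2) ++ rest
    ≡⟨ ListP.++-assoc (map root-edge (upTo j)) _ rest ⟨
  (map root-edge (upTo j) ++ map root-edge (applyUpTo (λ k → j + k) 2)) ++ rest
    ≡⟨ cong (_++ rest) (ListP.map-++ root-edge (upTo j) _) ⟨
  map root-edge (upTo j ++ applyUpTo (λ k → j + k) 2) ++ rest
    ≡⟨ cong (λ ks → map root-edge ks ++ rest) (applyUpTo-+ id j 2) ⟨
  star 0 1 (j + 2) ++ rest ∎
  where
  open ≡-Reasoning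
  root-edge : ℕ → ℕ × ℕ
  root-edge k = (0 , 1 + k)
  rest : List (ℕ × ℕ)
  rest = star (j + 1) (j + 3) a ++ star (j + 2) (j + 3 + a) b
  shift : ∀ j i → j + suc i ≡ suc (j + i)
  shift = solve-∀
  middle : (0 , j + 1) ∷ (0 , j + 2) ∷ [] ≡ map root-edge (applyUpTo (λ k → j + k) 2)
  middle = cong₂ (λ x y → (0 , x) ∷ (0 , y) ∷ []) (shift j 0) (shift j 1)

RT-incidentSum : ∀ j a b v F → incidentSum v F (edges (RT j a b)) ≡
  starSum v 0 1 (j + 2) F
    +ᶻ (starSum v (j + 1) (j + 3) a (λ k → F (j + 2 + k))
    +ᶻ starSum v (j + 2) (j + 3 + a) b (λ k → F (j + 2 + (a + k))))
RT-incidentSum j a b v F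
  rewrite RT-edges j a b
        | incidentSum-++ v F (star 0 1 (j + 2)) (star (j + 1) (j + 3) a ++ star (j + 2) (j + 3 + a) b)
        | length-star 0 1 (j + 2)
        | incidentSum-++ v (λ t → F (j + 2 + t)) (star (j + 1) (j + 3) a) (star (j + 2) (j + 3 + a) b)
        | length-star (j + 1) (j + 3) a
        | incidentSum-star v 0 1 (j + 2) F
        | incidentSum-star v (j + 1) (j + 3) a (λ k → F (j + 2 + k))
        | incidentSum-star v (j + 2) (j + 3 + a) b (λ k → F (j + 2 + (a + k)))
        = refl

j<j+ : ∀ j k → j < j + suc k
j<j+ j k = ℕP.m<m+n j (s≤s z≤n)

0<j+ : ∀ j k → 0 < j + suc k
0<j+ j k = ℕP.≤-<-trans z≤n (j<j+ j k)

j+1<j+2 : ∀ j → suc j < j + 2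
j+1<j+2 j = subst (_< j + 2) (ℕP.+-comm j 1) (ℕP.+-monoʳ-< j (ℕP.n<1+n 1))

j+2<1+j+2+ : ∀ j x → j + 2 < suc (j + 2 + x)
j+2<1+j+2+ j x = s≤s (ℕP.m≤m+n (j + 2) x)

RT-root : ∀ j a b F → incidentSum 0 F (edges (RT j a b)) ≡ sumTo (j + 2) F
RT-root j a b F =
  trans (RT-incidentSum j a b 0 F)
   (trans (cong₂ _+ᶻ_ (starSum-centre 0 0 1 (j + 2) F refl)
                      (cong₂ _+ᶻ_ (starSum-away 0 (j + 1) (j + 3) a _ (ℕP.<⇒≢ (0<j+ j 0)) (inj₁ (0<j+ j 2)))
                                  (starSum-away 0 (j + 2) (j + 3 + a) b _ (ℕP.<⇒≢ (0<j+ j 1)) (inj₁ (ℕP.<-≤-trans (0<j+ j 2) (ℕP.m≤m+n (j + 3) a))))))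
          (ℤP.+-identityʳ _))

RT-left : ∀ j a b F → incidentSum (suc j) F (edges (RT j a b)) ≡ F j +ᶻ sumTo a (λ k → F (j + 2 + k))
RT-left j a b F =
  trans (RT-incidentSum j a b (suc j) F)
   (cong₂ _+ᶻ_ (starSum-leaf (suc j) 0 1 (j + 2) F j (j<j+ j 1) refl (λ ()))
     (trans (cong₂ _+ᶻ_ (starSum-centre (suc j) (j + 1) (j + 3) a _ (ℕP.+-comm 1 j))
                        (starSum-away (suc j) (j + 2) (j + 3 + a) b _ (ℕP.<⇒≢ (j+1<j+2 j))
                                      (inj₁ (ℕP.<-≤-trans (j+1<j+2 j) j+2≤j+3+a))))
            (ℤP.+-identityʳ _)))
  where
  j+2≤j+3+a : j + 2 ≤ j + 3 + a
  j+2≤j+3+a = ℕP.≤-trans (ℕP.+-monoʳ-≤ j (ℕP.n≤1+n 2)) (ℕP.m≤m+n (j + 3) a)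

RT-right : ∀ j a b F → incidentSum (suc (suc j)) F (edges (RT j a b)) ≡ F (suc j) +ᶻ sumTo b (λ k → F (j + 2 + (a + k)))
RT-right j a b F =
  trans (RT-incidentSum j a b (suc (suc j)) F)
   (cong₂ _+ᶻ_ (starSum-leaf (suc (suc j)) 0 1 (j + 2) F (suc j) (j+1<j+2 j) refl (λ ()))
     (trans (cong₂ _+ᶻ_ (starSum-away (suc (suc j)) (j + 1) (j + 3) a _
                           (≢-sym (ℕP.<⇒≢ (subst (j + 1 <_) (sym 2+j≡j+2) (ℕP.+-monoʳ-< j (ℕP.n<1+n 1)))))
                           (inj₁ (subst (_< j + 3) (sym 2+j≡j+2) (ℕP.+-monoʳ-< j (ℕP.n<1+n 2)))))
                        (starSum-centre (suc (suc j)) (j + 2) (j + 3 + a) b _ 2+j≡j+2))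
            (ℤP.+-identityˡ _)))
  where
  2+j≡j+2 : 2 + j ≡ j + 2
  2+j≡j+2 = ℕP.+-comm 2 j

RT-rootLeaf : ∀ j a b F t → t < j → incidentSum (suc t) F (edges (RT j a b)) ≡ F t
RT-rootLeaf j a b F t t<j =
  trans (RT-incidentSum j a b (suc t) F)
   (trans (cong₂ _+ᶻ_ (starSum-leaf (suc t) 0 1 (j + 2) F t (ℕP.<-trans t<j (j<j+ j 1)) refl (λ ()))
            (cong₂ _+ᶻ_ (starSum-away (suc t) (j + 1) (j + 3) a _ (ℕP.<⇒≢ (below 0)) (inj₁ (below 2)))
                        (starSum-away (suc t) (j + 2) (j + 3 + a) b _ (ℕP.<⇒≢ (below 1))
                                      (inj₁ (ℕP.<-≤-trans (below 2) (ℕP.m≤m+n (j + 3) a))))))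
          (ℤP.+-identityʳ (F t)))
  where
  below : ∀ k → suc t < j + suc k
  below k = ℕP.≤-<-trans t<j (j<j+ j k)

RT-leftLeaf : ∀ j a b F k → k < a → incidentSum (suc (j + 2 + k)) F (edges (RT j a b)) ≡ F (j + 2 + k)
RT-leftLeaf j a b F k k<a =
  trans (RT-incidentSum j a b v F)
   (trans (cong₂ _+ᶻ_ (starSum-away v 0 1 (j + 2) F (λ ()) (inj₂ (j+2<1+j+2+ j k)))
            (cong₂ _+ᶻ_ (starSum-leaf v (j + 1) (j + 3) a _ k k<a (shift j k)
                                      (≢-sym (ℕP.<⇒≢ (ℕP.<-trans (ℕP.+-monoʳ-< j (ℕP.n<1+n 1)) (j+2<1+j+2+ j k)))))
                        (starSum-away v (j + 2) (j + 3 + a) b _ (≢-sym (ℕP.<⇒≢ (j+2<1+j+2+ j k)))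
                                      (inj₁ (subst (v <_) (shift j a) (s≤s (ℕP.+-monoʳ-< (j + 2) k<a)))))))
          (trans (ℤP.+-identityˡ _) (ℤP.+-identityʳ _)))
  where
  v : ℕ
  v = suc (j + 2 + k)
  shift : ∀ j k → suc (j + 2 + k) ≡ j + 3 + k
  shift = solve-∀

RT-rightLeaf : ∀ j a b F k → k < b → incidentSum (suc (j + 2 + (a + k))) F (edges (RT j a b)) ≡ F (j + 2 + (a + k))
RT-rightLeaf j a b F k k<b =
  trans (RT-incidentSum j a b v F)
   (trans (cong₂ _+ᶻ_ (starSum-away v 0 1 (j + 2) F (λ ()) (inj₂ (j+2<1+j+2+ j (a + k))))
            (cong₂ _+ᶻ_ (starSum-away v (j + 1) (j + 3) a _
                           (≢-sym (ℕP.<⇒≢ (ℕP.<-trans (ℕP.+-monoʳ-< j (ℕP.n<1+n 1)) (j+2<1+j+2+ j (a + k)))))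
                           (inj₂ (subst (j + 3 + a ≤_) (sym (shift j a k)) (ℕP.m≤m+n (j + 3 + a) k))))
                        (starSum-leaf v (j + 2) (j + 3 + a) b _ k k<b (shift j a k)
                           (≢-sym (ℕP.<⇒≢ (j+2<1+j+2+ j (a + k)))))))
          (trans (ℤP.+-identityˡ _) (ℤP.+-identityˡ _)))
  where
  v : ℕ
  v = suc (j + 2 + (a + k))
  shift : ∀ j a k → suc (j + 2 + (a + k)) ≡ j + 3 + a + k
  shift = solve-∀

RT-leaf : ∀ j a b F t → t < j + 2 + a + b → t ≢ j → t ≢ suc j → incidentSum (suc t) F (edges (RT j a b)) ≡ F t
RT-leaf j a b F t t<q t≢j t≢1+j with <-split (j + 2) t
... | inj₁ t<j+2 = RT-rootLeaf j a b F t t<j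
  where
  t<2+j : t < suc (suc j)
  t<2+j = subst (t <_) (ℕP.+-comm j 2) t<j+2
  t<j : t < j
  t<j = ℕP.≤∧≢⇒< (ℕP.≤-pred (ℕP.≤∧≢⇒< (ℕP.≤-pred t<2+j) t≢1+j)) t≢j
... | inj₂ (k , refl) with <-split a k
...   | inj₁ k<a = RT-leftLeaf j a b F k k<a
...   | inj₂ (k′ , refl) = RT-rightLeaf j a b F k′
                             (ℕP.+-cancelˡ-< (j + 2 + a) k′ b (subst (_< j + 2 + a + b) (sym (ℕP.+-assoc (j + 2) a k′)) t<q))

RT-q : ∀ j a b → q (RT j a b) ≡ j + 2 + a + b
RT-q j a b rewrite RT-edges j a b
  | ListP.length-++ (star 0 1 (j + 2)) {star (j + 1) (j + 3) a ++ star (j + 2) (j + 3 + a) b}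
  | ListP.length-++ (star (j + 1) (j + 3) a) {star (j + 2) (j + 3 + a) b}
  | length-star 0 1 (j + 2) | length-star (j + 1) (j + 3) a | length-star (j + 2) (j + 3 + a) b
  = sym (ℕP.+-assoc (j + 2) a b)

RT-vertexLabels : ∀ j a b (F L : ℕ → ℤ) →
  sumTo (j + 2) F ≡ L 0 →
  F j +ᶻ sumTo a (λ k → F (j + 2 + k)) ≡ L (suc j) →
  F (suc j) +ᶻ sumTo b (λ k → F (j + 2 + (a + k))) ≡ L (suc (suc j)) →
  (∀ t → t < j + 2 + a + b → t ≢ j → t ≢ suc j → F t ≡ L (suc t)) →
  ∀ v → v < p (RT j a b) → incidentSum v F (edges (RT j a b)) ≡ L v
RT-vertexLabels j a b F L root left right leaf zero _ = trans (RT-root j a b F) root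
RT-vertexLabels j a b F L root left right leaf (suc t) 1+t<p with t ≟ j | t ≟ suc j
... | yes refl | _ = trans (RT-left t a b F) left
... | no _ | yes refl = trans (RT-right j a b F) right
... | no t≢j | no t≢1+j = trans (RT-leaf j a b F t t<q t≢j t≢1+j) (leaf t t<q t≢j t≢1+j)
  where
  p≡1+q : ∀ j a b → j + a + b + 3 ≡ suc (j + 2 + a + b)
  p≡1+q = solve-∀
  t<q : t < j + 2 + a + b
  t<q = ℕP.≤-pred (subst (suc t <_) (p≡1+q j a b) 1+t<p)

superEdgeGraceful-byPermutations : ∀ G {S T : ℕ → ℤ} {π ρ : ℕ → ℕ} →
  Enumerates (q G) S → Permutes (q G) π → Enumerates (p G) T → Permutes (p G) ρ →
  (∀ v → v < p G → incidentSum v (S ∘ π) (edges G) ≡ T (ρ v)) → SuperEdgeGraceful G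
superEdgeGraceful-byPermutations G {S} {T} {π} {ρ} S-enum π-perm T-enum ρ-perm labels =
  (λ e → S (π (toℕ e))) ,
  BijOnto-enumerate∘permute S-enum π-perm ,
  BijOnto-cong (λ v → sym (trans (inducedLabel≡incidentSum G (S ∘ π) v) (labels (toℕ v) (FinP.toℕ<n v))))
               (BijOnto-enumerate∘permute T-enum ρ-perm)

concatAt : ℕ → (ℕ → ℕ) → (ℕ → ℕ) → ℕ → ℕ
concatAt j f g t = if t <ᵇ j then f t else g (t ∸ j)

concatAt-< : ∀ {j t} f g → t < j → concatAt j f g t ≡ f t
concatAt-< {j} {t} f g t<j rewrite dec-true (t <? j) t<j = refl

concatAt-+ : ∀ j f g d → concatAt j f g (j + d) ≡ g d
concatAt-+ j f g d rewrite dec-false (j + d <? j) (ℕP.m+n≮m j d) | ℕP.m+n∸m≡n j d = refl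

concatAt-into : ∀ {j m n} f g → (∀ t → t < j → f t < n) → (∀ d → d < m → g d < n) →
  ∀ t → t < j + m → concatAt j f g t < n
concatAt-into {j} f g f-into g-into t t<j+m with <-split j t
... | inj₁ t<j = subst (_< _) (sym (concatAt-< f g t<j)) (f-into t t<j)
... | inj₂ (d , refl) = subst (_< _) (sym (concatAt-+ j f g d)) (g-into d (ℕP.+-cancelˡ-< j d _ t<j+m))

-- In zigzag order the edge labels go to (0, j+1), (j+1, j+3), the leaves of j+2, the
-- leaves of the root, and (0, j+2); the last j+1 of them cancel in pairs, so the root gets 1
-- and j+1 gets 1 − 1 = 0.  Leaves repeat their edge labels, so ρ is π shifted by one in
-- zigzag₀ order, with the labels 0 and 1 swapped for the root and j+1.
module EvenB (s c : ℕ) where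

  j b M : ℕ
  j = suc (2 * s)
  b = 2 * c
  M = s + c + 2

  Q : ℕ
  Q = j + 2 + 1 + b

  Q≡3+j+b : Q ≡ 3 + (j + b)
  Q≡3+j+b = solve j b
    where
    solve : ∀ j b → j + 2 + 1 + b ≡ 3 + (j + b)
    solve = solve-∀

  Q≡j+[3+b] : Q ≡ j + (3 + b)
  Q≡j+[3+b] = solve j b
    where
    solve : ∀ j b → j + 2 + 1 + b ≡ j + (3 + b)
    solve = solve-∀

  π-rest : ℕ → ℕ
  π-rest 0 = 0
  π-rest 1 = 2 + (j + b)
  π-rest 2 = 1
  π-rest (suc (suc (suc k))) = 2 + k

  π-root : ℕ → ℕ
  π-root t = b + 2 + t

  π : ℕ → ℕ
  π = concatAt j π-root π-rest

  π-into : ∀ t → t < Q → π t < Q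
  π-into t t<Q = subst (π t <_) (sym Q≡3+j+b) (concatAt-into π-root π-rest root-into rest-into t (subst (t <_) Q≡j+[3+b] t<Q))
    where
    root-into : ∀ t → t < j → b + 2 + t < 3 + (j + b)
    root-into t t<j = subst (_< 3 + (j + b)) (solve b t) (s≤s (s≤s (s≤s (ℕP.+-monoˡ-≤ b (ℕP.<⇒≤ t<j)))))
      where
      solve : ∀ b t → 2 + (t + b) ≡ b + 2 + t
      solve = solve-∀
    rest-into : ∀ d → d < 3 + b → π-rest d < 3 + (j + b)
    rest-into 0 _ = s≤s z≤n
    rest-into 1 _ = ℕP.n<1+n _
    rest-into 2 _ = s≤s (s≤s z≤n)
    rest-into (suc (suc (suc k))) (s≤s (s≤s (s≤s k<b))) = s≤s (s≤s (s≤s (ℕP.≤-trans (ℕP.<⇒≤ k<b) (ℕP.m≤n+m b j))))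

  π-rest-at : ∀ d → π (j + d) ≡ π-rest d
  π-rest-at = concatAt-+ j π-root π-rest

  π-root-at : ∀ {t} → t < j → π t ≡ b + 2 + t
  π-root-at = concatAt-< π-root π-rest

  j+<Q : ∀ d → d < 3 + b → j + d < Q
  j+<Q d d<3+b = subst (j + d <_) (sym Q≡j+[3+b]) (ℕP.+-monoʳ-< j d<3+b)

  π-onto : ∀ r → r < Q → ∃ λ t → t < Q × π t ≡ r
  π-onto 0 _ = j + 0 , j+<Q 0 (s≤s z≤n) , π-rest-at 0
  π-onto 1 _ = j + 2 , j+<Q 2 (s≤s (s≤s (s≤s z≤n))) , π-rest-at 2
  π-onto (suc (suc r)) r+2<Q with <-split b r
  ... | inj₁ r<b = j + (3 + r) , j+<Q (3 + r) (s≤s (s≤s (s≤s r<b))) , π-rest-at (3 + r)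
  ... | inj₂ (i , refl) with <-split j i
  ...   | inj₁ i<j = i , ℕP.<-trans i<j (subst (_< Q) (ℕP.+-identityʳ j) (j+<Q 0 (s≤s z≤n))) , trans (π-root-at i<j) (solve b i)
    where
    solve : ∀ b i → b + 2 + i ≡ 2 + (b + i)
    solve = solve-∀
  ...   | inj₂ (w , refl) with ℕP.n<1⇒n≡0 w<1
    where
    w<1 : w < 1
    w<1 = ℕP.+-cancelˡ-< (2 + (j + b)) w 1 (subst₂ _<_ (solve₁ b j w) (trans Q≡3+j+b (solve₂ j b)) r+2<Q)
      where
      solve₁ : ∀ b j w → 2 + (b + (j + w)) ≡ 2 + (j + b) + w
      solve₁ = solve-∀
      solve₂ : ∀ j b → 3 + (j + b) ≡ 2 + (j + b) + 1
      solve₂ = solve-∀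
  ...     | refl = j + 1 , j+<Q 1 (s≤s (s≤s z≤n)) , trans (π-rest-at 1) (solve j b)
    where
    solve : ∀ j b → 2 + (j + b) ≡ 2 + (b + (j + 0))
    solve = solve-∀

  π-permutes : Permutes Q π
  π-permutes = π-into , π-onto

  ρ : ℕ → ℕ
  ρ = transpose 0 1 ∘ lift π

  ρ-permutes : Permutes (suc Q) ρ
  ρ-permutes = Permutes-∘ (Permutes-transpose (s≤s z≤n) (s≤s 0<Q)) (Permutes-lift π-permutes)
    where
    0<Q : 0 < Q
    0<Q = subst (0 <_) (sym Q≡3+j+b) (s≤s z≤n)

  F : ℕ → ℤ
  F t = zigzag (π t)

  π-j : π j ≡ 0
  π-j = trans (cong π (sym (ℕP.+-identityʳ j))) (π-rest-at 0)

  π-1+j : π (suc j) ≡ 2 + (j + b)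
  π-1+j = trans (cong π (ℕP.+-comm 1 j)) (π-rest-at 1)

  leaf-vertex : ∀ t → π t ≢ 0 → zigzag₀ (ρ (suc t)) ≡ F t
  leaf-vertex t πt≢0 = cong zigzag₀ (transpose-≢ 0 1 (λ ()) (πt≢0 ∘ ℕP.suc-injective))

  root-edges-cancel : sumTo j F +ᶻ F (suc j) ≡ + 0
  root-edges-cancel = begin
    sumTo j F +ᶻ F (suc j)           ≡⟨ cong₂ _+ᶻ_ (sumTo-cong j (λ t t<j → cong zigzag (π-root-at t<j)))
                                                  (cong zigzag (trans π-1+j (solve j b))) ⟩
    sumTo j G +ᶻ G j                 ≡⟨ sumTo-snoc j G ⟨
    sumTo (suc j) G                  ≡⟨ cong (λ n → sumTo n G) (ℕP.*-suc 2 s) ⟨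
    sumTo (2 * suc s) G              ≡⟨ sumTo-zigzag-cancel (suc s) (suc c) (b+2≡2*[1+c] c) ⟩
    + 0                              ∎
    where
    open ≡-Reasoning
    G : ℕ → ℤ
    G t = zigzag (b + 2 + t)
    solve : ∀ j b → 2 + (j + b) ≡ b + 2 + j
    solve = solve-∀
    b+2≡2*[1+c] : ∀ c → 2 * c + 2 ≡ 2 * suc c
    b+2≡2*[1+c] = solve-∀

  root-label : sumTo (j + 2) F ≡ zigzag₀ (ρ 0)
  root-label = begin
    sumTo (j + 2) F                  ≡⟨ sumTo-+2 j F ⟩
    sumTo j F +ᶻ F j +ᶻ F (suc j)    ≡⟨ ℤP.+-assoc (sumTo j F) (F j) (F (suc j)) ⟩
    sumTo j F +ᶻ (F j +ᶻ F (suc j))  ≡⟨ cong (sumTo j F +ᶻ_) (ℤP.+-comm (F j) (F (suc j))) ⟩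
    sumTo j F +ᶻ (F (suc j) +ᶻ F j)  ≡⟨ ℤP.+-assoc (sumTo j F) (F (suc j)) (F j) ⟨
    sumTo j F +ᶻ F (suc j) +ᶻ F j    ≡⟨ cong₂ _+ᶻ_ root-edges-cancel (cong zigzag π-j) ⟩
    + 1                              ∎
    where open ≡-Reasoning

  left-label : F j +ᶻ sumTo 1 (λ k → F (j + 2 + k)) ≡ zigzag₀ (ρ (suc j))
  left-label = trans (cong₂ (λ x y → zigzag x +ᶻ (zigzag y +ᶻ + 0)) π-j π-j+2)
                     (cong (zigzag₀ ∘ transpose 0 1 ∘ suc) (sym π-j))
    where
    π-j+2 : π (j + 2 + 0) ≡ 1
    π-j+2 = trans (cong π (ℕP.+-identityʳ (j + 2))) (π-rest-at 2)

  right-label : F (suc j) +ᶻ sumTo b (λ k → F (j + 2 + (1 + k))) ≡ zigzag₀ (ρ (suc (suc j)))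
  right-label = begin
    F (suc j) +ᶻ sumTo b (λ k → F (j + 2 + (1 + k)))  ≡⟨ cong (F (suc j) +ᶻ_) leaves-cancel ⟩
    F (suc j) +ᶻ + 0                                  ≡⟨ ℤP.+-identityʳ (F (suc j)) ⟩
    F (suc j)                                         ≡⟨ leaf-vertex (suc j) (λ π≡0 → ℕP.0≢1+n (trans (sym π≡0) π-1+j)) ⟨
    zigzag₀ (ρ (suc (suc j)))                         ∎
    where
    open ≡-Reasoning
    solve : ∀ j k → j + 2 + (1 + k) ≡ j + (3 + k)
    solve = solve-∀
    leaves-cancel : sumTo b (λ k → F (j + 2 + (1 + k))) ≡ + 0
    leaves-cancel = trans (sumTo-cong b (λ k _ → cong zigzag (trans (cong π (solve j k)) (π-rest-at (3 + k)))))
                          (sumTo-zigzag-cancel c 1 refl)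

  leaf-label : ∀ t → t < j + 2 + 1 + b → t ≢ j → t ≢ suc j → F t ≡ zigzag₀ (ρ (suc t))
  leaf-label t t<Q t≢j _ = sym (leaf-vertex t (λ πt≡0 → t≢j (Permutes-injective π-permutes t<Q j<Q (trans πt≡0 (sym π-j)))))
    where
    j<Q : j < Q
    j<Q = subst (_< Q) (ℕP.+-identityʳ j) (j+<Q 0 (s≤s z≤n))

  superEdgeGraceful : SuperEdgeGraceful (RT j 1 b)
  superEdgeGraceful = superEdgeGraceful-byPermutations (RT j 1 b)
    (subst (λ n → Enumerates n zigzag) (sym (trans (RT-q j 1 b) (q≡2M s c))) (zigzag-enumerates M))
    (subst (λ n → Permutes n π) (sym (RT-q j 1 b)) π-permutes)
    (subst (λ n → Enumerates n zigzag₀) (sym (p≡1+2M s c)) (zigzag₀-enumerates M))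
    (subst (λ n → Permutes n ρ) (sym (p≡1+Q j b)) ρ-permutes)
    (RT-vertexLabels j 1 b F (zigzag₀ ∘ ρ) root-label left-label right-label leaf-label)
    where
    q≡2M : ∀ s c → suc (2 * s) + 2 + 1 + 2 * c ≡ 2 * (s + c + 2)
    q≡2M = solve-∀
    p≡1+2M : ∀ s c → suc (2 * s) + 1 + 2 * c + 3 ≡ suc (2 * (s + c + 2))
    p≡1+2M = solve-∀
    p≡1+Q : ∀ j b → j + 1 + b + 3 ≡ suc (j + 2 + 1 + b)
    p≡1+Q = solve-∀

-- b odd, j + b = 2K.  The root edges carry −1, −2, 3 and then cancelling pairs, (0, j+1) carries
-- K+1 and (0, j+2) carries 0.  The vertex labels missed by the leaves are K+1 and ±(K+2): the
-- root gets K+1, j+1 gets (K+1) + 1, and j+2 gets 2 − 3 − (K+1) plus cancelling pairs.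
module OddB (s c : ℕ) where

  j b : ℕ
  j = 3 + 2 * s
  b = 3 + 2 * c

  Q : ℕ
  Q = j + 2 + 1 + b

  Q≡3+j+b : Q ≡ 3 + (j + b)
  Q≡3+j+b = solve j b
    where
    solve : ∀ j b → j + 2 + 1 + b ≡ 3 + (j + b)
    solve = solve-∀

  Q≡9+2s+2c : Q ≡ 9 + (2 * s + 2 * c)
  Q≡9+2s+2c = solve s c
    where
    solve : ∀ s c → 3 + 2 * s + 2 + 1 + (3 + 2 * c) ≡ 9 + (2 * s + 2 * c)
    solve = solve-∀

  Q≡j+[3+b] : Q ≡ j + (3 + b)
  Q≡j+[3+b] = solve j b
    where
    solve : ∀ j b → j + 2 + 1 + b ≡ j + (3 + b)
    solve = solve-∀

  ≤8⇒<Q : ∀ {k} → k ≤ 8 → k < Q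
  ≤8⇒<Q {k} k≤8 = subst (k <_) (sym Q≡9+2s+2c) (s≤s (ℕP.≤-trans k≤8 (ℕP.m≤m+n 8 _)))

  π-root : ℕ → ℕ
  π-root 0 = 2
  π-root 1 = 4
  π-root 2 = 5
  π-root (suc (suc (suc u))) = 7 + u

  π-rest : ℕ → ℕ
  π-rest 0 = suc (j + b)
  π-rest 1 = 0
  π-rest 2 = 1
  π-rest 3 = 3
  π-rest 4 = 6
  π-rest 5 = 2 + (j + b)
  π-rest (suc (suc (suc (suc (suc (suc u)))))) = 4 + (j + u)

  π : ℕ → ℕ
  π = concatAt j π-root π-rest

  π-rest-at : ∀ d → π (j + d) ≡ π-rest d
  π-rest-at = concatAt-+ j π-root π-rest

  π-root-at : ∀ {t} → t < j → π t ≡ π-root t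
  π-root-at = concatAt-< π-root π-rest

  π-into : ∀ t → t < Q → π t < Q
  π-into t t<Q = concatAt-into π-root π-rest root-into rest-into t (subst (t <_) Q≡j+[3+b] t<Q)
    where
    root-into : ∀ t → t < j → π-root t < Q
    root-into 0 _ = ≤8⇒<Q (ℕP.m≤m+n 2 6)
    root-into 1 _ = ≤8⇒<Q (ℕP.m≤m+n 4 4)
    root-into 2 _ = ≤8⇒<Q (ℕP.m≤m+n 5 3)
    root-into (suc (suc (suc u))) (s≤s (s≤s (s≤s u<2s))) =
      subst (7 + u <_) (sym Q≡9+2s+2c) (ℕP.+-monoʳ-< 7 (ℕP.m≤n⇒m≤1+n (ℕP.m≤n⇒m≤1+n (ℕP.≤-trans u<2s (ℕP.m≤m+n (2 * s) (2 * c))))))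
    below-3+j+b : ∀ {k} → k < 3 + (j + b) → k < Q
    below-3+j+b {k} = subst (k <_) (sym Q≡3+j+b)
    rest-into : ∀ d → d < 3 + b → π-rest d < Q
    rest-into 0 _ = below-3+j+b (ℕP.m<n⇒m<1+n (ℕP.n<1+n _))
    rest-into 1 _ = ≤8⇒<Q z≤n
    rest-into 2 _ = ≤8⇒<Q (s≤s z≤n)
    rest-into 3 _ = ≤8⇒<Q (ℕP.m≤m+n 3 5)
    rest-into 4 _ = ≤8⇒<Q (ℕP.m≤m+n 6 2)
    rest-into 5 _ = below-3+j+b (ℕP.n<1+n _)
    rest-into (suc (suc (suc (suc (suc (suc u)))))) (s≤s (s≤s (s≤s u<b))) =
      below-3+j+b (s≤s (s≤s (s≤s (subst (_≤ j + b) (solve j u)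
        (ℕP.+-monoʳ-≤ j (ℕP.≤-trans (ℕP.n≤1+n (2 + u)) (ℕP.<⇒≤ u<b)))))))
      where
      solve : ∀ j u → j + (2 + u) ≡ 2 + (j + u)
      solve = solve-∀

  j+<Q : ∀ d → d < 3 + b → j + d < Q
  j+<Q d d<3+b = subst (j + d <_) (sym Q≡j+[3+b]) (ℕP.+-monoʳ-< j d<3+b)

  j+≤5<Q : ∀ d → d ≤ 5 → j + d < Q
  j+≤5<Q d d≤5 = j+<Q d (s≤s (ℕP.≤-trans d≤5 (ℕP.+-monoʳ-≤ 3 (ℕP.m≤m+n 2 _))))

  ≤2<j : ∀ {t} → t ≤ 2 → t < j
  ≤2<j t≤2 = s≤s (ℕP.≤-trans t≤2 (ℕP.m≤m+n 2 _))

  j<Q : j < Q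
  j<Q = subst (_< Q) (ℕP.+-identityʳ j) (j+≤5<Q 0 z≤n)

  π-onto : ∀ r → r < Q → ∃ λ t → t < Q × π t ≡ r
  π-onto 0 _ = j + 1 , j+≤5<Q 1 (s≤s z≤n) , π-rest-at 1
  π-onto 1 _ = j + 2 , j+≤5<Q 2 (s≤s (s≤s z≤n)) , π-rest-at 2
  π-onto 2 _ = 0 , ≤8⇒<Q z≤n , π-root-at (≤2<j z≤n)
  π-onto 3 _ = j + 3 , j+≤5<Q 3 (s≤s (s≤s (s≤s z≤n))) , π-rest-at 3
  π-onto 4 _ = 1 , ≤8⇒<Q (s≤s z≤n) , π-root-at (≤2<j (s≤s z≤n))
  π-onto 5 _ = 2 , ≤8⇒<Q (s≤s (s≤s z≤n)) , π-root-at (≤2<j (s≤s (s≤s z≤n)))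
  π-onto 6 _ = j + 4 , j+≤5<Q 4 (s≤s (s≤s (s≤s (s≤s z≤n)))) , π-rest-at 4
  π-onto (suc (suc (suc (suc (suc (suc (suc u))))))) 7+u<Q with <-split (2 * s) u
  ... | inj₁ u<2s = 3 + u , ℕP.<-trans 3+u<j j<Q , π-root-at 3+u<j
    where
    3+u<j : 3 + u < j
    3+u<j = s≤s (s≤s (s≤s u<2s))
  ... | inj₂ (w , refl) with <-split (2 * c) w
  ...   | inj₁ w<2c = j + (6 + w) , j+<Q (6 + w) (s≤s (s≤s (s≤s (ℕP.+-monoʳ-< 3 w<2c)))) , π-rest-at (6 + w)
  ...   | inj₂ (y , refl) with y<2
    where
    y<2 : y < 2
    y<2 = ℕP.+-cancelˡ-< (7 + (2 * s + 2 * c)) y 2 (subst₂ _<_ (solve₁ s c y) (trans Q≡9+2s+2c (solve₂ s c)) 7+u<Q)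
      where
      solve₁ : ∀ s c y → 7 + (2 * s + (2 * c + y)) ≡ 7 + (2 * s + 2 * c) + y
      solve₁ = solve-∀
      solve₂ : ∀ s c → 9 + (2 * s + 2 * c) ≡ 7 + (2 * s + 2 * c) + 2
      solve₂ = solve-∀
  ...     | s≤s z≤n = j + 0 , j+≤5<Q 0 z≤n , trans (π-rest-at 0) (solve s c)
    where
    solve : ∀ s c → suc (3 + 2 * s + (3 + 2 * c)) ≡ 7 + (2 * s + (2 * c + 0))
    solve = solve-∀
  ...     | s≤s (s≤s z≤n) = j + 5 , j+≤5<Q 5 ℕP.≤-refl , trans (π-rest-at 5) (solve s c)
    where
    solve : ∀ s c → 2 + (3 + 2 * s + (3 + 2 * c)) ≡ 7 + (2 * s + (2 * c + 1))
    solve = solve-∀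

  π-permutes : Permutes Q π
  π-permutes = π-into , π-onto

  -- lift shifts up by one and the double rotation down by two, so leaf t+1 gets zigzag (π t − 1),
  -- i.e. zigzag₀ (π t); the wrap-around sends j+1 and j+2 to the two top labels.
  ρ : ℕ → ℕ
  ρ = rotate (suc Q) ∘ rotate (suc Q) ∘ lift π ∘ transpose 0 (suc j)

  ρ-permutes : Permutes (suc Q) ρ
  ρ-permutes = Permutes-∘ (Permutes-rotate (suc Q)) (Permutes-∘ (Permutes-rotate (suc Q))
                 (Permutes-∘ (Permutes-lift π-permutes) (Permutes-transpose (s≤s z≤n) (s≤s j<Q))))

  F : ℕ → ℤ
  F t = zigzag₀ (π t)

  π-j : π j ≡ suc (j + b)
  π-j = trans (cong π (sym (ℕP.+-identityʳ j))) (π-rest-at 0)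

  π-1+j : π (suc j) ≡ 0
  π-1+j = trans (cong π (ℕP.+-comm 1 j)) (π-rest-at 1)

  j+b≡2K : j + b ≡ 2 * (s + c + 3)
  j+b≡2K = solve s c
    where
    solve : ∀ s c → 3 + 2 * s + (3 + 2 * c) ≡ 2 * (s + c + 3)
    solve = solve-∀

  leaf-vertex : ∀ t → t ≢ j → π t ≢ 0 → zigzag (ρ (suc t)) ≡ F t
  leaf-vertex t t≢j πt≢0 =
    trans (cong (zigzag ∘ rotate (suc Q) ∘ rotate (suc Q) ∘ lift π) (transpose-≢ 0 (suc j) (λ ()) (t≢j ∘ ℕP.suc-injective)))
          (drop-zero (π t) πt≢0)
    where
    drop-zero : ∀ x → x ≢ 0 → zigzag (rotate (suc Q) (rotate (suc Q) (suc x))) ≡ zigzag₀ x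
    drop-zero zero x≢0 = ⊥-elim (x≢0 refl)
    drop-zero (suc x) _ = refl

  root-label : sumTo (j + 2) F ≡ zigzag (ρ 0)
  root-label = begin
    sumTo (j + 2) F                    ≡⟨ sumTo-+2 j F ⟩
    sumTo j F +ᶻ F j +ᶻ F (suc j)      ≡⟨ cong₂ (λ x y → x +ᶻ zigzag₀ y +ᶻ F (suc j)) root-edges-cancel π-j ⟩
    + 0 +ᶻ zigzag (j + b) +ᶻ F (suc j) ≡⟨ cong (λ x → + 0 +ᶻ zigzag (j + b) +ᶻ zigzag₀ x) π-1+j ⟩
    + 0 +ᶻ zigzag (j + b) +ᶻ + 0       ≡⟨ trans (ℤP.+-identityʳ _) (ℤP.+-identityˡ _) ⟩
    zigzag (j + b)                     ≡⟨ cong (zigzag ∘ rotate (suc Q) ∘ rotate (suc Q) ∘ suc) π-j ⟨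
    zigzag (ρ 0)                       ∎
    where
    open ≡-Reasoning
    root-edges-cancel : sumTo j F ≡ + 0
    root-edges-cancel = cong (λ x → F 0 +ᶻ (F 1 +ᶻ (F 2 +ᶻ x)))
      (trans (sumTo-cong (2 * s) (λ u u<2s → cong zigzag₀ (π-root-at (s≤s (s≤s (s≤s u<2s))))))
             (sumTo-zigzag-cancel s 3 refl))

  rotate²-0 : rotate (suc Q) (rotate (suc Q) 0) ≡ 2 + (j + b)
  rotate²-0 = cong (rotate (suc Q)) Q≡3+j+b

  left-label : F j +ᶻ sumTo 1 (λ k → F (j + 2 + k)) ≡ zigzag (ρ (suc j))
  left-label = begin
    F j +ᶻ sumTo 1 (λ k → F (j + 2 + k))  ≡⟨ cong₂ (λ x y → zigzag₀ x +ᶻ (zigzag₀ y +ᶻ + 0)) π-j π-j+2 ⟩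
    zigzag (j + b) +ᶻ + 1                 ≡⟨ even-step (j + b) (s + c + 3) j+b≡2K ⟩
    zigzag (2 + (j + b))                  ≡⟨ cong zigzag rotate²-0 ⟨
    zigzag (rotate (suc Q) (rotate (suc Q) 0)) ≡⟨ cong (zigzag ∘ rotate (suc Q) ∘ rotate (suc Q) ∘ lift π) (transpose-≡ʳ 0 (suc j)) ⟨
    zigzag (ρ (suc j))                    ∎
    where
    open ≡-Reasoning
    π-j+2 : π (j + 2 + 0) ≡ 1
    π-j+2 = trans (cong π (ℕP.+-identityʳ (j + 2))) (π-rest-at 2)
    even-step : ∀ n K → n ≡ 2 * K → zigzag n +ᶻ + 1 ≡ zigzag (2 + n)
    even-step _ K refl rewrite zigzag-even K = cong +_ (ℕP.+-comm (suc K) 1)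

  right-label : F (suc j) +ᶻ sumTo b (λ k → F (j + 2 + (1 + k))) ≡ zigzag (ρ (suc (suc j)))
  right-label = begin
    F (suc j) +ᶻ sumTo b (λ k → F (j + 2 + (1 + k)))
      ≡⟨ cong₂ _+ᶻ_ (cong zigzag₀ π-1+j)
                    (sumTo-cong b (λ k _ → cong zigzag₀ (trans (cong π (solve j k)) (π-rest-at (3 + k))))) ⟩
    + 0 +ᶻ sumTo b (λ k → zigzag₀ (π-rest (3 + k)))
      ≡⟨ cong (λ x → + 0 +ᶻ (+ 2 +ᶻ (-[1+ 2 ] +ᶻ (zigzag (suc (j + b)) +ᶻ x)))) (sumTo-zigzag-cancel c (3 + s) 6+2s≡) ⟩
    + 0 +ᶻ (+ 2 +ᶻ (-[1+ 2 ] +ᶻ (zigzag (suc (j + b)) +ᶻ + 0)))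
      ≡⟨ trans (ℤP.+-identityˡ _) (odd-step (j + b) (s + c + 3) j+b≡2K) ⟩
    zigzag (3 + (j + b))
      ≡⟨ cong zigzag Q≡3+j+b ⟨
    zigzag (rotate (suc Q) (rotate (suc Q) 1))
      ≡⟨ cong (zigzag ∘ rotate (suc Q) ∘ rotate (suc Q) ∘ suc) π-1+j ⟨
    zigzag (rotate (suc Q) (rotate (suc Q) (lift π (suc (suc j)))))
      ≡⟨ cong (zigzag ∘ rotate (suc Q) ∘ rotate (suc Q) ∘ lift π) (transpose-≢ 0 (suc j) (λ ()) ℕP.1+n≢n) ⟨
    zigzag (ρ (suc (suc j)))
      ∎
    where
    open ≡-Reasoning
    solve : ∀ j k → j + 2 + (1 + k) ≡ j + (3 + k)
    solve = solve-∀
    6+2s≡ : 6 + 2 * s ≡ 2 * (3 + s)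
    6+2s≡ = solve-∀′ s
      where
      solve-∀′ : ∀ s → 6 + 2 * s ≡ 2 * (3 + s)
      solve-∀′ = solve-∀
    odd-step : ∀ n K → n ≡ 2 * K → + 2 +ᶻ (-[1+ 2 ] +ᶻ (zigzag (suc n) +ᶻ + 0)) ≡ zigzag (3 + n)
    odd-step _ K refl rewrite zigzag-odd K = refl

  leaf-label : ∀ t → t < j + 2 + 1 + b → t ≢ j → t ≢ suc j → F t ≡ zigzag (ρ (suc t))
  leaf-label t t<Q t≢j t≢1+j =
    sym (leaf-vertex t t≢j (λ πt≡0 → t≢1+j (Permutes-injective π-permutes t<Q 1+j<Q (trans πt≡0 (sym π-1+j)))))
    where
    1+j<Q : suc j < Q
    1+j<Q = subst (_< Q) (ℕP.+-comm j 1) (j+≤5<Q 1 (s≤s z≤n))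

  superEdgeGraceful : SuperEdgeGraceful (RT j 1 b)
  superEdgeGraceful = superEdgeGraceful-byPermutations (RT j 1 b)
    (subst (λ n → Enumerates n zigzag₀) (sym (trans (RT-q j 1 b) (q≡1+2N s c))) (zigzag₀-enumerates (s + c + 4)))
    (subst (λ n → Permutes n π) (sym (RT-q j 1 b)) π-permutes)
    (subst (λ n → Enumerates n zigzag) (sym (p≡2N s c)) (zigzag-enumerates (s + c + 5)))
    (subst (λ n → Permutes n ρ) (sym (p≡1+Q j b)) ρ-permutes)
    (RT-vertexLabels j 1 b F (zigzag ∘ ρ) root-label left-label right-label leaf-label)
    where
    q≡1+2N : ∀ s c → 3 + 2 * s + 2 + 1 + (3 + 2 * c) ≡ suc (2 * (s + c + 4))
    q≡1+2N = solve-∀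
    p≡2N : ∀ s c → 3 + 2 * s + 1 + (3 + 2 * c) + 3 ≡ 2 * (s + c + 5)
    p≡2N = solve-∀
    p≡1+Q : ∀ j b → j + 1 + b + 3 ≡ suc (j + 2 + 1 + b)
    p≡1+Q = solve-∀

lemma6 : ∀ (j b : ℕ) → Odd j → 3 ≤ j → 3 ≤ b → SuperEdgeGraceful (RT j 1 b)
lemma6 _ b (zero , refl) (s≤s ()) _
lemma6 _ b (suc s , refl) _ 3≤b with even⊎odd b
... | c , inj₁ refl = EvenB.superEdgeGraceful (suc s) c
... | zero , inj₂ refl = ⊥-elim (ℕP.≤⇒≯ 3≤b (s≤s (s≤s z≤n)))
... | suc c , inj₂ refl =
  subst₂ (λ j b → SuperEdgeGraceful (RT j 1 b)) (3+2n≡1+2[1+n] s) (3+2n≡1+2[1+n] c) (OddB.superEdgeGraceful s c)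
  where
  3+2n≡1+2[1+n] : ∀ n → 3 + 2 * n ≡ suc (2 * suc n)
  3+2n≡1+2[1+n] n = cong suc (sym (ℕP.*-suc 2 n))
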